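{- Let $G$ be a connected graph on $n$ vertices and $m$ edges with maximum degree $\Delta$. Then $$\sigma_{t}(G)\geq \frac{(n\Delta-2m)^{2}}{n-1}.$$ Equality holds if and only if $G$ has one vertex of maximum degree $\Delta$ and the remaining $n-1$ vertices have degree $\frac{2m-\Delta}{n-1}$.
   Context: For a finite simple graph $G$ with $d(v)$ the degree of $v$, $\sigma_{t}(G)=\sum_{\{u,v\}\subseteq V(G)}(d(u)-d(v))^{2}$, summing over all unordered pairs of distinct vertices. -}

module Defs where

open import Data.Bool using (Bool; true; false; T; if_then_else_)
open import Data.Nat using (ℕ; _⊔_; _<?_)
open import Data.Fin using (Fin; toℕ)
open import Data.Nat.ListAction using (sum)
open import Data.List using (List; []; _∷_; map; allFin; concatMap; foldr)
open import Data.Product using (_×_; _,_)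
open import Data.Integer using (ℤ; +_; _-_; _*_)
open import Relation.Binary.PropositionalEquality using (_≡_)
open import Relation.Nullary.Decidable using (⌊_⌋)
open import Relation.Binary.Construct.Closure.ReflexiveTransitive using (Star)

record Graph (n : ℕ) : Set where
  field
    adj    : Fin n → Fin n → Bool
    sym    : ∀ i j → adj i j ≡ adj j i
    irrefl : ∀ i → adj i i ≡ false
open Graph public

Adj : ∀ {n} → Graph n → Fin n → Fin n → Set
Adj G i j = T (adj G i j)

Connected : ∀ {n} → Graph n → Set
Connected G = ∀ i j → Star (Adj G) i j

b2n : Bool → ℕ
b2n true  = 1
b2n false = 0

deg : ∀ {n} → Graph n → Fin n → ℕ
deg {n} G i = sum (map (λ j → b2n (adj G i j)) (allFin n))

maxDeg : ∀ {n} → Graph n → ℕ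
maxDeg {n} G = foldr _⊔_ 0 (map (deg G) (allFin n))

-- unordered pairs {i,j} of distinct vertices, each listed once as (i , j) with i < j
pairs : (n : ℕ) → List (Fin n × Fin n)
pairs n = concatMap (λ i → concatMap (λ j →
            if ⌊ toℕ i <? toℕ j ⌋ then (i , j) ∷ [] else []) (allFin n)) (allFin n)

edges : ∀ {n} → Graph n → ℕ
edges {n} G = sum (map (λ { (i , j) → b2n (adj G i j) }) (pairs n))

sigmaT : ∀ {n} → Graph n → ℤ
sigmaT {n} G = foldr Data.Integer._+_ (+ 0)
  (map (λ { (i , j) → (+ deg G i - + deg G j) * (+ deg G i - + deg G j) }) (pairs n))

{-# OPTIONS --safe #-}
module Submission where

-- Write d for the degree vector, so that Σ d = 2m. Lagrange's identity turns σ_t into the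
-- "scatter" n Σ d² − (Σ d)². Splitting off one vertex v, a direct computation gives
--   (n − 1) σ_t = (n d_v − 2m)² + n · σ_t′,
-- where σ_t′ is the scatter of the degrees of the other n − 1 vertices. Hence σ_t′ ≥ 0 yields the
-- bound, with equality iff those n − 1 degrees coincide, i.e. all equal (2m − d_v)/(n − 1).
-- Taking v of maximum degree gives the theorem.

open import Defs
open import Algebra.Bundles using (AbelianGroup)
open import Data.Bool using (true; false; if_then_else_)
open import Data.Fin using (Fin; zero; suc; toℕ; punchIn; punchOut)
open import Data.Fin.Properties using (toℕ-injective; punchIn-punchOut; punchInᵢ≢i)
open import Data.Integer as ℤ using (ℤ; +_; -[1+_]; 0ℤ; _+_; _-_; _*_; -_; +≤+)
open import Data.Integer.Properties as ℤP
  using (+-*-semiring; +-identityˡ; +-identityʳ; +-assoc; *-identityʳ; *-comm; *-zeroˡ; *-zeroʳ;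
         suc-*; pos-+; pos-*; +-mono-≤; +-monoʳ-≤; ≤-antisym; ≤-refl; *-monoˡ-≤-nonNeg;
         *-cancelˡ-≡; *-cancelʳ-≡; *-cancelˡ-≤-pos; i-j≡0⇒i≡j; i*j≡0⇒i≡0∨j≡0)
open import Data.Integer.Tactic.RingSolver using (solve-∀)
open import Algebra.Properties.Group (AbelianGroup.group ℤP.+-0-abelianGroup)
  using (identityʳ-unique)
open import Algebra.Properties.Semiring.Sum +-*-semiring
  using (sum; sum-syntax; sum-cong-≗; sum-replicate-zero; sum-remove; ∑-distrib-+; ∑-comm;
         *-distribˡ-sum)
open import Data.List using (List; []; _∷_; _++_; map; foldr; tabulate; concatMap; allFin)
open import Data.List.Properties using (map-tabulate; map-concatMap)
open import Data.List.Membership.Propositional using (_∈_)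
open import Data.List.Membership.Propositional.Properties using (foldr-selective; ∈-map⁻)
open import Data.List.Relation.Unary.Any using (here; there)
open import Data.Nat using (ℕ; zero; suc; _<?_; _⊔_)
import Data.Nat as ℕ
import Data.Nat.Properties as ℕP
open import Data.Nat.ListAction using () renaming (sum to sumℕ)
open import Data.Product using (Σ; ∃-syntax; _×_; _,_; uncurry)
open import Data.Rational using (_/_; _≤_)
import Data.Rational.Properties as ℚP
import Data.Rational.Unnormalised as ℚᵘ
import Data.Rational.Unnormalised.Properties as ℚᵘP
open import Data.Sum using (inj₁; inj₂; reduce)
open import Data.Vec.Functional using (removeAt)
open import Function using (id; _∘_; _⇔_; mk⇔; Equivalence)
open import Function.Properties.Equivalence using (⇔-setoid)
open import Level using (0ℓ)
open import Relation.Nullary using (yes; no; contradiction)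
open import Relation.Nullary.Decidable using (⌊_⌋)
import Relation.Binary.Reasoning.Setoid as SetoidReasoning
open import Relation.Binary.PropositionalEquality as ≡
  using (_≡_; _≢_; refl; trans; cong; cong₂; subst; subst₂; module ≡-Reasoning)

∑-const : ∀ n c → ∑[ i < n ] c ≡ + n * c
∑-const zero    c = ≡.sym (*-zeroˡ c)
∑-const (suc n) c = trans (cong (_+_ c) (∑-const n c)) (≡.sym (suc-* (+ n) c))

∑-affine : ∀ n (x y z : ℤ) (g h : Fin n → ℤ) →
  ∑[ i < n ] (x * g i + y * h i + z) ≡ x * sum g + y * sum h + + n * z
∑-affine n x y z g h = begin
  ∑[ i < n ] (x * g i + y * h i + z)
    ≡⟨ ∑-distrib-+ (λ i → x * g i + y * h i) (λ _ → z) ⟩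
  ∑[ i < n ] (x * g i + y * h i) + ∑[ i < n ] z
    ≡⟨ cong₂ _+_ (∑-distrib-+ (λ i → x * g i) (λ i → y * h i)) (∑-const n z) ⟩
  ∑[ i < n ] (x * g i) + ∑[ i < n ] (y * h i) + + n * z
    ≡⟨ cong (_+ + n * z) (cong₂ _+_ (*-distribˡ-sum x g) (*-distribˡ-sum y h)) ⟨
  x * sum g + y * sum h + + n * z
    ∎
  where open ≡-Reasoning

∑-zero : ∀ {n} (f : Fin n → ℤ) → (∀ i → f i ≡ 0ℤ) → sum f ≡ 0ℤ
∑-zero {n} f f≡0 = trans (sum-cong-≗ f≡0) (sum-replicate-zero n)

∑-nonneg : ∀ {n} (f : Fin n → ℤ) → (∀ i → 0ℤ ℤ.≤ f i) → 0ℤ ℤ.≤ sum f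
∑-nonneg {zero}  f f≥0 = ≤-refl
∑-nonneg {suc n} f f≥0 = +-mono-≤ (f≥0 zero) (∑-nonneg (f ∘ suc) (f≥0 ∘ suc))

∑-nonneg≡0⇒≡0 : ∀ {n} (f : Fin n → ℤ) → (∀ i → 0ℤ ℤ.≤ f i) →
  sum f ≡ 0ℤ → ∀ i → f i ≡ 0ℤ
∑-nonneg≡0⇒≡0 {suc n} f f≥0 ∑f≡0 i = ≤-antisym fᵢ≤0 (f≥0 i)
  where
  open ℤP.≤-Reasoning
  fᵢ≤0 : f i ℤ.≤ 0ℤ
  fᵢ≤0 = begin
    f i                       ≡⟨ +-identityʳ (f i) ⟨
    f i + 0ℤ                  ≤⟨ +-monoʳ-≤ (f i) (∑-nonneg (removeAt f i) (f≥0 ∘ punchIn i)) ⟩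
    f i + sum (removeAt f i)  ≡⟨ sum-remove {i = i} f ⟨
    sum f                     ≡⟨ ∑f≡0 ⟩
    0ℤ                        ∎

square-nonneg : ∀ a → 0ℤ ℤ.≤ a * a
square-nonneg (+ n)    = subst (0ℤ ℤ.≤_) (pos-* n n) (+≤+ ℕ.z≤n)
square-nonneg -[1+ n ] = +≤+ ℕ.z≤n

square≡0⇒≡0 : ∀ a → a * a ≡ 0ℤ → a ≡ 0ℤ
square≡0⇒≡0 a a²≡0 = reduce (i*j≡0⇒i≡0∨j≡0 a a²≡0)

square-diff-comm : ∀ a b → (a - b) * (a - b) ≡ (b - a) * (b - a)
square-diff-comm = solve-∀

square-diff-self : ∀ a → (a - a) * (a - a) ≡ 0ℤ
square-diff-self = solve-∀

x≡x+y⇔y≡0 : ∀ x y → (x ≡ x + y) ⇔ (y ≡ 0ℤ)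
x≡x+y⇔y≡0 x y = mk⇔ (λ eq → identityʳ-unique x y (≡.sym eq))
                    (λ y≡0 → ≡.sym (trans (cong (_+_ x) y≡0) (+-identityʳ x)))

1+n*x≡0⇔x≡0 : ∀ n x → (+ suc n * x ≡ 0ℤ) ⇔ (x ≡ 0ℤ)
1+n*x≡0⇔x≡0 n x = mk⇔
  (λ eq → *-cancelˡ-≡ (+ suc n) x 0ℤ (trans eq (≡.sym (*-zeroʳ (+ suc n)))))
  (λ x≡0 → trans (cong (_*_ (+ suc n)) x≡0) (*-zeroʳ (+ suc n)))

sumSq : ∀ {n} → (Fin n → ℤ) → ℤ
sumSq {n} f = ∑[ i < n ] (f i * f i)

-- n² times the variance of f.
scatter : ∀ {n} → (Fin n → ℤ) → ℤ
scatter {n} f = + n * sumSq f - sum f * sum f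

lagrange-identity : ∀ {n} (f : Fin n → ℤ) →
  ∑[ i < n ] ∑[ j < n ] ((f i - f j) * (f i - f j)) ≡ + 2 * scatter f
lagrange-identity {n} f = begin
  ∑[ i < n ] ∑[ j < n ] ((f i - f j) * (f i - f j))
    ≡⟨ sum-cong-≗ row ⟩
  ∑[ i < n ] (+ n * (f i * f i) + - (+ 2 * sum f) * f i + sumSq f)
    ≡⟨ ∑-affine n (+ n) (- (+ 2 * sum f)) (sumSq f) (λ i → f i * f i) f ⟩
  + n * sumSq f + - (+ 2 * sum f) * sum f + + n * sumSq f
    ≡⟨ collect (+ n) (sumSq f) (sum f) ⟩
  + 2 * scatter f
    ∎
  where
  open ≡-Reasoning
  expand : ∀ a b → (a - b) * (a - b) ≡ + 1 * (b * b) + - (+ 2 * a) * b + a * a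
  expand = solve-∀
  regroup : ∀ a Q S N → + 1 * Q + - (+ 2 * a) * S + N * (a * a) ≡ N * (a * a) + - (+ 2 * S) * a + Q
  regroup = solve-∀
  collect : ∀ N Q S → N * Q + - (+ 2 * S) * S + N * Q ≡ + 2 * (N * Q - S * S)
  collect = solve-∀
  row : ∀ i → ∑[ j < n ] ((f i - f j) * (f i - f j))
            ≡ + n * (f i * f i) + - (+ 2 * sum f) * f i + sumSq f
  row i = trans (sum-cong-≗ (λ j → expand (f i) (f j)))
         (trans (∑-affine n (+ 1) (- (+ 2 * f i)) (f i * f i) (λ j → f j * f j) f)
                (regroup (f i) (sumSq f) (sum f) (+ n)))

scatter-nonneg : ∀ {n} (f : Fin n → ℤ) → 0ℤ ℤ.≤ scatter f
scatter-nonneg f = *-cancelˡ-≤-pos 0ℤ (scatter f) (+ 2)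
  (subst (0ℤ ℤ.≤_) (lagrange-identity f)
    (∑-nonneg _ (λ i → ∑-nonneg _ (λ j → square-nonneg (f i - f j)))))

scatter≡0⇔constant : ∀ {n} (f : Fin n → ℤ) → scatter f ≡ 0ℤ ⇔ (∀ i j → f i ≡ f j)
scatter≡0⇔constant {n} f = mk⇔ constant
  (λ f-const → *-cancelˡ-≡ (+ 2) (scatter f) 0ℤ
    (trans (≡.sym (lagrange-identity f)) (∑-zero _ (λ i → ∑-zero _ (sq-const f-const i)))))
  where
  sq : Fin n → Fin n → ℤ
  sq i j = (f i - f j) * (f i - f j)
  sq-const : (∀ i j → f i ≡ f j) → ∀ i j → sq i j ≡ 0ℤ
  sq-const f-const i j =
    trans (cong (λ t → (f i - t) * (f i - t)) (≡.sym (f-const i j))) (square-diff-self (f i))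
  constant : scatter f ≡ 0ℤ → ∀ i j → f i ≡ f j
  constant s≡0 i j = i-j≡0⇒i≡j (f i) (f j) (square≡0⇒≡0 (f i - f j) (sq≡0 i j))
    where
    sq-nonneg : ∀ i j → 0ℤ ℤ.≤ sq i j
    sq-nonneg i j = square-nonneg (f i - f j)
    ∑∑sq≡0 : ∑[ i < n ] sum (sq i) ≡ 0ℤ
    ∑∑sq≡0 = trans (lagrange-identity f) (cong (_*_ (+ 2)) s≡0)
    sq≡0 : ∀ i j → sq i j ≡ 0ℤ
    sq≡0 i = ∑-nonneg≡0⇒≡0 (sq i) (sq-nonneg i)
      (∑-nonneg≡0⇒≡0 (λ i → sum (sq i)) (λ i → ∑-nonneg (sq i) (sq-nonneg i)) ∑∑sq≡0 i)

deviation : ∀ {n} → (Fin (suc n) → ℤ) → Fin (suc n) → ℤ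
deviation {n} f v = + suc n * f v - sum f

scatter-removeAt : ∀ {n} (f : Fin (suc n) → ℤ) v →
  + n * scatter f ≡ deviation f v * deviation f v + + suc n * scatter (removeAt f v)
scatter-removeAt {n} f v = begin
  + n * scatter f
    ≡⟨ cong₂ (λ Q S → + n * (+ suc n * Q - S * S))
             (sum-remove {i = v} (λ i → f i * f i)) (sum-remove {i = v} f) ⟩
  + n * (+ suc n * (f v * f v + sumSq r) - (f v + sum r) * (f v + sum r))
    ≡⟨ split (+ n) (f v) (sum r) (sumSq r) ⟩
  (+ suc n * f v - (f v + sum r)) * (+ suc n * f v - (f v + sum r)) + + suc n * scatter r
    ≡⟨ cong (λ S → (+ suc n * f v - S) * (+ suc n * f v - S) + + suc n * scatter r)
            (sum-remove {i = v} f) ⟨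
  deviation f v * deviation f v + + suc n * scatter r
    ∎
  where
  open ≡-Reasoning
  r : Fin n → ℤ
  r = removeAt f v
  split : ∀ N x S Q →
    N * ((+ 1 + N) * (x * x + Q) - (x + S) * (x + S))
      ≡ ((+ 1 + N) * x - (x + S)) * ((+ 1 + N) * x - (x + S)) + (+ 1 + N) * (N * Q - S * S)
  split = solve-∀

sq-deviation≤scatter : ∀ {n} (f : Fin (suc n) → ℤ) v →
  deviation f v * deviation f v ℤ.≤ + n * scatter f
sq-deviation≤scatter {n} f v = begin
  d²                                       ≡⟨ +-identityʳ d² ⟨
  d² + 0ℤ                                  ≡⟨ cong (_+_ d²) (*-zeroʳ (+ suc n)) ⟨
  d² + + suc n * 0ℤ                        ≤⟨ +-monoʳ-≤ d² (*-monoˡ-≤-nonNeg (+ suc n) rest≥0) ⟩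
  d² + + suc n * scatter (removeAt f v)    ≡⟨ scatter-removeAt f v ⟨
  + n * scatter f                          ∎
  where
  open ℤP.≤-Reasoning
  d² : ℤ
  d² = deviation f v * deviation f v
  rest≥0 : 0ℤ ℤ.≤ scatter (removeAt f v)
  rest≥0 = scatter-nonneg (removeAt f v)

sq-deviation≡scatter⇔constant : ∀ {n} (f : Fin (suc n) → ℤ) v →
  (deviation f v * deviation f v ≡ + n * scatter f) ⇔ (∀ i j → removeAt f v i ≡ removeAt f v j)
sq-deviation≡scatter⇔constant {n} f v = begin
  (d² ≡ + n * scatter f)             ≡⟨ cong (d² ≡_) (scatter-removeAt f v) ⟩
  (d² ≡ d² + + suc n * scatter r)    ≈⟨ x≡x+y⇔y≡0 d² (+ suc n * scatter r) ⟩
  (+ suc n * scatter r ≡ 0ℤ)         ≈⟨ 1+n*x≡0⇔x≡0 n (scatter r) ⟩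
  (scatter r ≡ 0ℤ)                   ≈⟨ scatter≡0⇔constant r ⟩
  (∀ i j → r i ≡ r j)                ∎
  where
  open SetoidReasoning (⇔-setoid 0ℓ)
  r : Fin n → ℤ
  r = removeAt f v
  d² : ℤ
  d² = deviation f v * deviation f v

constant⇔*≡sum : ∀ {n} (r : Fin (suc n) → ℤ) →
  (∀ i j → r i ≡ r j) ⇔ (∀ i → r i * + suc n ≡ sum r)
constant⇔*≡sum {n} r = mk⇔ to from
  where
  to : (∀ i j → r i ≡ r j) → ∀ i → r i * + suc n ≡ sum r
  to r-const i = begin
    r i * + suc n         ≡⟨ *-comm (r i) (+ suc n) ⟩
    + suc n * r i         ≡⟨ ∑-const (suc n) (r i) ⟨
    ∑[ j < suc n ] r i    ≡⟨ sum-cong-≗ (r-const i) ⟩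
    sum r                 ∎
    where open ≡-Reasoning
  from : (∀ i → r i * + suc n ≡ sum r) → ∀ i j → r i ≡ r j
  from r≡mean i j = *-cancelʳ-≡ (r i) (r j) (+ suc n) (trans (r≡mean i) (≡.sym (r≡mean j)))

∀-punchIn⇔∀-≢ : ∀ {n} {P : Fin (suc n) → Set} v →
  (∀ i → P (punchIn v i)) ⇔ (∀ u → u ≢ v → P u)
∀-punchIn⇔∀-≢ {P = P} v = mk⇔
  (λ h u u≢v → subst P (punchIn-punchOut (u≢v ∘ ≡.sym)) (h (punchOut (u≢v ∘ ≡.sym))))
  (λ h i → h (punchIn v i) (punchInᵢ≢i v i))

sumℤ : List ℤ → ℤ
sumℤ = foldr _+_ 0ℤ

sumℤ-++ : ∀ xs ys → sumℤ (xs ++ ys) ≡ sumℤ xs + sumℤ ys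
sumℤ-++ []       ys = ≡.sym (+-identityˡ (sumℤ ys))
sumℤ-++ (x ∷ xs) ys =
  trans (cong (_+_ x) (sumℤ-++ xs ys)) (≡.sym (+-assoc x (sumℤ xs) (sumℤ ys)))

sumℤ-concatMap : ∀ {A : Set} (F : A → List ℤ) xs →
  sumℤ (concatMap F xs) ≡ sumℤ (map (sumℤ ∘ F) xs)
sumℤ-concatMap F []       = refl
sumℤ-concatMap F (x ∷ xs) =
  trans (sumℤ-++ (F x) (concatMap F xs)) (cong (_+_ (sumℤ (F x))) (sumℤ-concatMap F xs))

sumℤ-tabulate : ∀ {n} (f : Fin n → ℤ) → sumℤ (tabulate f) ≡ ∑[ i < n ] f i
sumℤ-tabulate {zero}  f = refl
sumℤ-tabulate {suc n} f = cong (_+_ (f zero)) (sumℤ-tabulate (f ∘ suc))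

sumℤ-allFin : ∀ n (f : Fin n → ℤ) → sumℤ (map f (allFin n)) ≡ ∑[ i < n ] f i
sumℤ-allFin n f = trans (cong sumℤ (map-tabulate id f)) (sumℤ-tabulate f)

sumℤ-if : ∀ {A : Set} (h : A → ℤ) b x →
  sumℤ (map h (if b then x ∷ [] else [])) ≡ (if b then h x else 0ℤ)
sumℤ-if h true  x = +-identityʳ (h x)
sumℤ-if h false x = refl

+-sumℕ : ∀ {A : Set} (f : A → ℕ) xs → + sumℕ (map f xs) ≡ sumℤ (map (λ x → + f x) xs)
+-sumℕ f []       = refl
+-sumℕ f (x ∷ xs) = trans (pos-+ (f x) (sumℕ (map f xs))) (cong (_+_ (+ f x)) (+-sumℕ f xs))

upperPart : ∀ {n} → (Fin n → Fin n → ℤ) → Fin n → Fin n → ℤ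
upperPart g i j = if ⌊ toℕ i <? toℕ j ⌋ then g i j else 0ℤ

sumℤ-pairs : ∀ n (g : Fin n → Fin n → ℤ) →
  sumℤ (map (uncurry g) (pairs n)) ≡ ∑[ i < n ] ∑[ j < n ] upperPart g i j
sumℤ-pairs n g = trans (sumℤ-concatMap-allFin _) (sum-cong-≗ λ i →
  trans (sumℤ-concatMap-allFin _) (sum-cong-≗ λ j →
    sumℤ-if (uncurry g) ⌊ toℕ i <? toℕ j ⌋ (i , j)))
  where
  sumℤ-concatMap-allFin : ∀ (F : Fin n → List (Fin n × Fin n)) →
    sumℤ (map (uncurry g) (concatMap F (allFin n))) ≡ ∑[ i < n ] sumℤ (map (uncurry g) (F i))
  sumℤ-concatMap-allFin F = begin
    sumℤ (map (uncurry g) (concatMap F (allFin n)))     ≡⟨ cong sumℤ (map-concatMap _ F (allFin n)) ⟩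
    sumℤ (concatMap (map (uncurry g) ∘ F) (allFin n))   ≡⟨ sumℤ-concatMap _ (allFin n) ⟩
    sumℤ (map (sumℤ ∘ map (uncurry g) ∘ F) (allFin n))  ≡⟨ sumℤ-allFin n _ ⟩
    ∑[ i < n ] sumℤ (map (uncurry g) (F i))             ∎
    where open ≡-Reasoning

∑∑-symmetric : ∀ {n} (g : Fin n → Fin n → ℤ) →
  (∀ i j → g i j ≡ g j i) → (∀ i → g i i ≡ 0ℤ) →
  ∑[ i < n ] ∑[ j < n ] g i j ≡ + 2 * ∑[ i < n ] ∑[ j < n ] upperPart g i j
∑∑-symmetric {n} g g-sym g-diag = begin
  ∑[ i < n ] ∑[ j < n ] g i j                       ≡⟨ sum-cong-≗ (λ i → sum-cong-≗ (split i)) ⟩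
  ∑[ i < n ] ∑[ j < n ] (U i j + U j i)             ≡⟨ sum-cong-≗ (λ i → ∑-distrib-+ (U i) (λ j → U j i)) ⟩
  ∑[ i < n ] (sum (U i) + ∑[ j < n ] U j i)         ≡⟨ ∑-distrib-+ (sum ∘ U) (λ i → ∑[ j < n ] U j i) ⟩
  ∑∑U + ∑[ i < n ] ∑[ j < n ] U j i                 ≡⟨ cong (_+_ ∑∑U) (∑-comm U) ⟨
  ∑∑U + ∑∑U                                         ≡⟨ double ∑∑U ⟩
  + 2 * ∑∑U                                         ∎
  where
  open ≡-Reasoning
  U : Fin n → Fin n → ℤ
  U = upperPart g
  ∑∑U : ℤ
  ∑∑U = ∑[ i < n ] ∑[ j < n ] U i j
  double : ∀ x → x + x ≡ + 2 * x
  double = solve-∀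
  split : ∀ i j → g i j ≡ U i j + U j i
  split i j with toℕ i <? toℕ j | toℕ j <? toℕ i
  ... | yes i<j | yes j<i = contradiction j<i (ℕP.<-asym i<j)
  ... | yes _   | no  _   = ≡.sym (+-identityʳ (g i j))
  ... | no  _   | yes _   = trans (g-sym i j) (≡.sym (+-identityˡ (g j i)))
  ... | no  i≮j | no  j≮i with toℕ-injective (ℕP.≤-antisym (ℕP.≮⇒≥ j≮i) (ℕP.≮⇒≥ i≮j))
  ...   | refl = g-diag i

∑∑≡2*sumℤ-pairs : ∀ {n} (g : Fin n → Fin n → ℤ) →
  (∀ i j → g i j ≡ g j i) → (∀ i → g i i ≡ 0ℤ) →
  ∑[ i < n ] ∑[ j < n ] g i j ≡ + 2 * sumℤ (map (uncurry g) (pairs n))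
∑∑≡2*sumℤ-pairs {n} g g-sym g-diag =
  trans (∑∑-symmetric g g-sym g-diag) (cong (_*_ (+ 2)) (≡.sym (sumℤ-pairs n g)))

foldr-⊔-∈ : ∀ x xs → foldr _⊔_ 0 (x ∷ xs) ∈ x ∷ xs
foldr-⊔-∈ x xs with ℕP.⊔-sel x (foldr _⊔_ 0 xs)
... | inj₁ x⊔m≡x = here x⊔m≡x
... | inj₂ x⊔m≡m with foldr-selective ℕP.⊔-sel 0 xs
...   | inj₁ m≡0  = here (trans (cong (x ⊔_) m≡0) (ℕP.⊔-identityʳ x))
...   | inj₂ m∈xs = there (subst (_∈ xs) (≡.sym x⊔m≡m) m∈xs)

/≡/⇔*≡* : ∀ p q a b → (p / suc a ≡ q / suc b) ⇔ (p * + suc b ≡ q * + suc a)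
/≡/⇔*≡* p q a b = mk⇔ to
  (λ cross → ℚP.fromℚᵘ-cong {ℚᵘ.mkℚᵘ p a} {ℚᵘ.mkℚᵘ q b} (ℚᵘ.*≡* cross))
  where
  to : p / suc a ≡ q / suc b → p * + suc b ≡ q * + suc a
  to eq with ℚP./-injective-≃ (ℚᵘ.mkℚᵘ p a) (ℚᵘ.mkℚᵘ q b) eq
  ... | ℚᵘ.*≡* cross = cross

*≤*⇒/≤/ : ∀ p q a b → p * + suc b ℤ.≤ q * + suc a → p / suc a ≤ q / suc b
*≤*⇒/≤/ p q a b cross = ℚP.toℚᵘ-cancel-≤
  (ℚᵘP.≤-respˡ-≃ (ℚᵘP.≃-sym (ℚP.toℚᵘ-fromℚᵘ (ℚᵘ.mkℚᵘ p a)))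
    (ℚᵘP.≤-respʳ-≃ (ℚᵘP.≃-sym (ℚP.toℚᵘ-fromℚᵘ (ℚᵘ.mkℚᵘ q b))) (ℚᵘ.*≤* cross)))

maxDeg-attained : ∀ {n} (G : Graph (suc n)) → ∃[ v ] deg G v ≡ maxDeg G
maxDeg-attained {n} G with ∈-map⁻ (deg G) {xs = allFin (suc n)} (foldr-⊔-∈ _ _)
... | v , _ , Δ≡deg = v , ≡.sym Δ≡deg

+deg≡∑adj : ∀ {n} (G : Graph n) i → + deg G i ≡ ∑[ j < n ] (+ b2n (adj G i j))
+deg≡∑adj {n} G i = trans (+-sumℕ (λ j → b2n (adj G i j)) (allFin n)) (sumℤ-allFin n _)

handshake : ∀ {n} (G : Graph n) → + (2 ℕ.* edges G) ≡ ∑[ i < n ] (+ deg G i)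
handshake {n} G = begin
  + (2 ℕ.* edges G)                       ≡⟨ pos-* 2 (edges G) ⟩
  + 2 * + edges G                         ≡⟨ cong (_*_ (+ 2)) (+-sumℕ _ (pairs n)) ⟩
  + 2 * sumℤ (map (uncurry A) (pairs n))  ≡⟨ ∑∑≡2*sumℤ-pairs A A-sym A-irrefl ⟨
  ∑[ i < n ] ∑[ j < n ] A i j             ≡⟨ sum-cong-≗ (≡.sym ∘ +deg≡∑adj G) ⟩
  ∑[ i < n ] (+ deg G i)                  ∎
  where
  open ≡-Reasoning
  A : Fin n → Fin n → ℤ
  A i j = + b2n (adj G i j)
  A-sym : ∀ i j → A i j ≡ A j i
  A-sym i j = cong (λ b → + b2n b) (Graph.sym G i j)
  A-irrefl : ∀ i → A i i ≡ 0ℤ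
  A-irrefl i = cong (λ b → + b2n b) (irrefl G i)

sigmaT≡scatter : ∀ {n} (G : Graph n) → sigmaT G ≡ scatter (λ i → + deg G i)
sigmaT≡scatter {n} G = *-cancelˡ-≡ (+ 2) (sigmaT G) (scatter d)
  (trans (≡.sym (∑∑≡2*sumℤ-pairs sq (λ i j → square-diff-comm (d i) (d j)) (square-diff-self ∘ d)))
         (lagrange-identity d))
  where
  d : Fin n → ℤ
  d i = + deg G i
  sq : Fin n → Fin n → ℤ
  sq i j = (d i - d j) * (d i - d j)

excess : ∀ {n} → Graph n → ℤ
excess {n} G = + (n ℕ.* maxDeg G) - + (2 ℕ.* edges G)

module _ {k} (G : Graph (suc (suc k))) where
  private
    d : Fin (suc (suc k)) → ℤ
    d i = + deg G i

  excess≡deviation : ∀ v → deg G v ≡ maxDeg G → excess G ≡ deviation d v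
  excess≡deviation v v-max = cong₂ _-_
    (trans (pos-* (suc (suc k)) (maxDeg G)) (cong (λ Δ → + suc (suc k) * + Δ) (≡.sym v-max)))
    (handshake G)

  sum-other-degrees : ∀ v → deg G v ≡ maxDeg G →
    sum (removeAt d v) ≡ + (2 ℕ.* edges G) - + maxDeg G
  sum-other-degrees v v-max = begin
    sum (removeAt d v)              ≡⟨ cancel (d v) (sum (removeAt d v)) ⟩
    d v + sum (removeAt d v) - d v  ≡⟨ cong (_- d v) (sum-remove {i = v} d) ⟨
    sum d - d v                     ≡⟨ cong₂ _-_ (handshake G) (cong +_ (≡.sym v-max)) ⟨
    + (2 ℕ.* edges G) - + maxDeg G  ∎
    where
    open ≡-Reasoning
    cancel : ∀ a b → b ≡ a + b - a
    cancel = solve-∀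

  sq-excess*1≡sq-deviation : ∀ v → deg G v ≡ maxDeg G →
    excess G * excess G * + 1 ≡ deviation d v * deviation d v
  sq-excess*1≡sq-deviation v v-max =
    trans (*-identityʳ _) (cong (λ e → e * e) (excess≡deviation v v-max))

  sigmaT*≡*scatter : sigmaT G * + suc k ≡ + suc k * scatter d
  sigmaT*≡*scatter = trans (*-comm (sigmaT G) _) (cong (_*_ (+ suc k)) (sigmaT≡scatter G))

  excess-bound : excess G * excess G / suc k ≤ sigmaT G / 1
  excess-bound with maxDeg-attained G
  ... | v , v-max = *≤*⇒/≤/ (excess G * excess G) (sigmaT G) k 0
    (subst₂ ℤ._≤_ (≡.sym (sq-excess*1≡sq-deviation v v-max)) (≡.sym sigmaT*≡*scatter)
      (sq-deviation≤scatter d v))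

  excess-tight⇔others-equal : ∀ v → deg G v ≡ maxDeg G →
    (excess G * excess G / suc k ≡ sigmaT G / 1)
    ⇔ (∀ u → u ≢ v → + deg G u / 1 ≡ (+ (2 ℕ.* edges G) - + maxDeg G) / suc k)
  excess-tight⇔others-equal v v-max = begin
    (excess G * excess G / suc k ≡ sigmaT G / 1)
      ≈⟨ /≡/⇔*≡* (excess G * excess G) (sigmaT G) k 0 ⟩
    (excess G * excess G * + 1 ≡ sigmaT G * + suc k)
      ≡⟨ cong₂ _≡_ (sq-excess*1≡sq-deviation v v-max) sigmaT*≡*scatter ⟩
    (deviation d v * deviation d v ≡ + suc k * scatter d)
      ≈⟨ sq-deviation≡scatter⇔constant d v ⟩
    (∀ i j → r i ≡ r j)
      ≈⟨ constant⇔*≡sum r ⟩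
    (∀ i → r i * + suc k ≡ sum r)
      ≡⟨ cong (λ t → ∀ i → r i * + suc k ≡ t)
              (trans (sum-other-degrees v v-max) (≡.sym (*-identityʳ c))) ⟩
    (∀ i → r i * + suc k ≡ c * + 1)
      ≈⟨ ∀-punchIn⇔∀-≢ v ⟩
    (∀ u → u ≢ v → d u * + suc k ≡ c * + 1)
      ≈⟨ mk⇔ (λ h u u≢v → Equivalence.from (/≡/⇔*≡* (d u) c 0 k) (h u u≢v))
             (λ h u u≢v → Equivalence.to (/≡/⇔*≡* (d u) c 0 k) (h u u≢v)) ⟩
    (∀ u → u ≢ v → d u / 1 ≡ c / suc k)
      ∎
    where
    open SetoidReasoning (⇔-setoid 0ℓ)
    r : Fin (suc k) → ℤ
    r = removeAt d v
    c : ℤ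
    c = + (2 ℕ.* edges G) - + maxDeg G

corollary15 : (k : ℕ) (G : Graph (suc (suc k))) → Connected G →
    ((((+ (suc (suc k) Data.Nat.* maxDeg G) - + (2 Data.Nat.* edges G))
        * (+ (suc (suc k) Data.Nat.* maxDeg G) - + (2 Data.Nat.* edges G))) / suc k)
      ≤ (sigmaT G / 1))
    × (((((+ (suc (suc k) Data.Nat.* maxDeg G) - + (2 Data.Nat.* edges G))
          * (+ (suc (suc k) Data.Nat.* maxDeg G) - + (2 Data.Nat.* edges G))) / suc k)
        ≡ (sigmaT G / 1))
       ⇔ Σ (Fin (suc (suc k))) (λ v → (deg G v ≡ maxDeg G)
           × (∀ u → u ≢ v → (+ deg G u / 1) ≡ ((+ (2 Data.Nat.* edges G) - + maxDeg G) / suc k))))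
corollary15 k G _ = excess-bound G , mk⇔
  (λ tight → let v , v-max = maxDeg-attained G
             in v , v-max , Equivalence.to (excess-tight⇔others-equal G v v-max) tight)
  (λ (v , v-max , others) → Equivalence.from (excess-tight⇔others-equal G v v-max) others)
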